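{- Let $P\colon\mathcal C\to\mathcal A$, $S\colon\mathcal A\to\mathcal C$ be a dual adjunction, $T\colon\mathcal C\to\mathcal C$ an endofunctor and $(L,\rho)$ a logic for $T$-coalgebras such that $L$ has an initial algebra $(\Phi,\alpha)$. If $X_1\xleftarrow{\pi_1}B\xrightarrow{\pi_2}X_2$ is a $\rho$-bisimulation between $T$-coalgebras $(X_1,\gamma_1)$ and $(X_2,\gamma_2)$, then $\mathrm{th}_{\gamma_1}\circ\pi_1=\mathrm{th}_{\gamma_2}\circ\pi_2$.
   Context: A dual adjunction between categories $\mathcal C$ and $\mathcal A$ consists of contravariant functors $P\colon\mathcal C\to\mathcal A$, $S\colon\mathcal A\to\mathcal C$ with a bijection $\mathcal C(X,SA)\cong\mathcal A(A,PX)$ natural in $X,A$; its unit on the $\mathcal C$ side is $\eta^{\mathcal C}\colon \mathrm{Id}_{\mathcal C}\to SP$. A $T$-coalgebra is a pair $(X,\gamma)$ with $\gamma\colon X\to TX$. A logic for $T$-coalgebras is a pair $(L,\rho)$ with $L\colon\mathcal A\to\mathcal A$ an endofunctor and $\rho\colon LP\to PT$ natural. The complex algebra of $(X,\gamma)$ is the $L$-algebra $\gamma^*=P\gamma\circ\rho_X\colon LPX\to PX$. The semantics $[\![-]\!]_\gamma\colon\Phi\to PX$ is the unique $L$-algebra morphism from $(\Phi,\alpha)$ to $(PX,\gamma^*)$, and the theory map is its adjoint transpose $\mathrm{th}_\gamma=S[\![-]\!]_\gamma\circ\eta^{\mathcal C}_X\colon X\to S\Phi$. A span $X_1\xleftarrow{\pi_1}B\xrightarrow{\pi_2}X_2$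 is jointly mono if $\pi_1h=\pi_1h'$ and $\pi_2h=\pi_2h'$ imply $h=h'$. Standing assumptions: $\mathcal C$ has pullbacks, and $\mathcal A$ has pullbacks or $\mathcal C$ has pushouts. The dual span $(\bar B,\bar\pi_1,\bar\pi_2)$ is the pullback in $\mathcal A$ of $PX_1\xrightarrow{P\pi_1}PB\xleftarrow{P\pi_2}PX_2$. A jointly mono span $(B,\pi_1,\pi_2)$ is a $\rho$-bisimulation between $(X_1,\gamma_1)$ and $(X_2,\gamma_2)$ if $P\pi_1\circ\gamma_1^*\circ L\bar\pi_1=P\pi_2\circ\gamma_2^*\circ L\bar\pi_2$. -}

module Defs where

open import Level using (Level; _⊔_) renaming (suc to lsuc)
open import Relation.Binary using (Rel; IsEquivalence)
open import Data.Product using (Σ; _×_; _,_)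
open import Data.Sum using (_⊎_)

record Category (o ℓ e : Level) : Set (lsuc (o ⊔ ℓ ⊔ e)) where
  infixr 9 _∘_
  infix  4 _≈_
  field
    Obj   : Set o
    _⇒_   : Obj → Obj → Set ℓ
    _≈_   : ∀ {A B} → Rel (A ⇒ B) e
    id    : ∀ {A} → A ⇒ A
    _∘_   : ∀ {A B C} → B ⇒ C → A ⇒ B → A ⇒ C
    assoc : ∀ {A B C D} {f : A ⇒ B} {g : B ⇒ C} {h : C ⇒ D} →
            (h ∘ g) ∘ f ≈ h ∘ (g ∘ f)
    identityˡ : ∀ {A B} {f : A ⇒ B} → id ∘ f ≈ f
    identityʳ : ∀ {A B} {f : A ⇒ B} → f ∘ id ≈ f
    equiv : ∀ {A B} → IsEquivalence (_≈_ {A} {B})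
    ∘-resp-≈ : ∀ {A B C} {f h : B ⇒ C} {g i : A ⇒ B} →
               f ≈ h → g ≈ i → f ∘ g ≈ h ∘ i

module _ {o ℓ e : Level} (𝒞 : Category o ℓ e) where
  open Category 𝒞

  record IsPullback {A B C P : Obj} (f : A ⇒ C) (g : B ⇒ C)
                    (p₁ : P ⇒ A) (p₂ : P ⇒ B) : Set (o ⊔ ℓ ⊔ e) where
    field
      commute   : f ∘ p₁ ≈ g ∘ p₂
      universal : ∀ {Q} (q₁ : Q ⇒ A) (q₂ : Q ⇒ B) → f ∘ q₁ ≈ g ∘ q₂ → Q ⇒ P
      p₁∘universal : ∀ {Q} {q₁ : Q ⇒ A} {q₂ : Q ⇒ B} (eq : f ∘ q₁ ≈ g ∘ q₂) →
                     p₁ ∘ universal q₁ q₂ eq ≈ q₁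
      p₂∘universal : ∀ {Q} {q₁ : Q ⇒ A} {q₂ : Q ⇒ B} (eq : f ∘ q₁ ≈ g ∘ q₂) →
                     p₂ ∘ universal q₁ q₂ eq ≈ q₂
      unique : ∀ {Q} (u v : Q ⇒ P) → p₁ ∘ u ≈ p₁ ∘ v → p₂ ∘ u ≈ p₂ ∘ v → u ≈ v

  record IsPushout {A B C P : Obj} (f : C ⇒ A) (g : C ⇒ B)
                   (i₁ : A ⇒ P) (i₂ : B ⇒ P) : Set (o ⊔ ℓ ⊔ e) where
    field
      commute   : i₁ ∘ f ≈ i₂ ∘ g
      universal : ∀ {Q} (q₁ : A ⇒ Q) (q₂ : B ⇒ Q) → q₁ ∘ f ≈ q₂ ∘ g → P ⇒ Q
      universal∘i₁ : ∀ {Q} {q₁ : A ⇒ Q} {q₂ : B ⇒ Q} (eq : q₁ ∘ f ≈ q₂ ∘ g) →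
                     universal q₁ q₂ eq ∘ i₁ ≈ q₁
      universal∘i₂ : ∀ {Q} {q₁ : A ⇒ Q} {q₂ : B ⇒ Q} (eq : q₁ ∘ f ≈ q₂ ∘ g) →
                     universal q₁ q₂ eq ∘ i₂ ≈ q₂
      unique : ∀ {Q} (u v : P ⇒ Q) → u ∘ i₁ ≈ v ∘ i₁ → u ∘ i₂ ≈ v ∘ i₂ → u ≈ v

  HasPullbacks : Set (o ⊔ ℓ ⊔ e)
  HasPullbacks = ∀ {A B C} (f : A ⇒ C) (g : B ⇒ C) →
    Σ Obj λ P → Σ (P ⇒ A) λ p₁ → Σ (P ⇒ B) λ p₂ → IsPullback f g p₁ p₂

  HasPushouts : Set (o ⊔ ℓ ⊔ e)
  HasPushouts = ∀ {A B C} (f : C ⇒ A) (g : C ⇒ B) →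
    Σ Obj λ P → Σ (A ⇒ P) λ i₁ → Σ (B ⇒ P) λ i₂ → IsPushout f g i₁ i₂

  JointlyMono : {X₁ X₂ B : Obj} (π₁ : B ⇒ X₁) (π₂ : B ⇒ X₂) → Set (o ⊔ ℓ ⊔ e)
  JointlyMono {B = B} π₁ π₂ = ∀ {Y} (h h′ : Y ⇒ B) →
    π₁ ∘ h ≈ π₁ ∘ h′ → π₂ ∘ h ≈ π₂ ∘ h′ → h ≈ h′

record Functor {o ℓ e o′ ℓ′ e′ : Level} (𝒞 : Category o ℓ e) (𝒟 : Category o′ ℓ′ e′)
       : Set (o ⊔ ℓ ⊔ e ⊔ o′ ⊔ ℓ′ ⊔ e′) where
  private module C = Category 𝒞
  private module D = Category 𝒟
  field
    F₀ : C.Obj → D.Obj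
    F₁ : ∀ {A B} → A C.⇒ B → F₀ A D.⇒ F₀ B
    identity : ∀ {A} → F₁ (C.id {A}) D.≈ D.id
    homomorphism : ∀ {A B C} {f : A C.⇒ B} {g : B C.⇒ C} →
                   F₁ (g C.∘ f) D.≈ F₁ g D.∘ F₁ f
    F-resp-≈ : ∀ {A B} {f g : A C.⇒ B} → f C.≈ g → F₁ f D.≈ F₁ g

record ContraFunctor {o ℓ e o′ ℓ′ e′ : Level} (𝒞 : Category o ℓ e) (𝒟 : Category o′ ℓ′ e′)
       : Set (o ⊔ ℓ ⊔ e ⊔ o′ ⊔ ℓ′ ⊔ e′) where
  private module C = Category 𝒞
  private module D = Category 𝒟
  field
    F₀ : C.Obj → D.Obj
    F₁ : ∀ {A B} → A C.⇒ B → F₀ B D.⇒ F₀ A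
    identity : ∀ {A} → F₁ (C.id {A}) D.≈ D.id
    homomorphism : ∀ {A B C} {f : A C.⇒ B} {g : B C.⇒ C} →
                   F₁ (g C.∘ f) D.≈ F₁ f D.∘ F₁ g
    F-resp-≈ : ∀ {A B} {f g : A C.⇒ B} → f C.≈ g → F₁ f D.≈ F₁ g

record DualAdjunction {o ℓ e o′ ℓ′ e′ : Level}
       {𝒞 : Category o ℓ e} {𝒜 : Category o′ ℓ′ e′}
       (P : ContraFunctor 𝒞 𝒜) (S : ContraFunctor 𝒜 𝒞)
       : Set (o ⊔ ℓ ⊔ e ⊔ o′ ⊔ ℓ′ ⊔ e′) where
  private module C = Category 𝒞
  private module A = Category 𝒜
  private module P = ContraFunctor P
  private module S = ContraFunctor S
  field
    φ : ∀ {X A} → X C.⇒ S.F₀ A → A A.⇒ P.F₀ X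
    ψ : ∀ {X A} → A A.⇒ P.F₀ X → X C.⇒ S.F₀ A
    φ-resp-≈ : ∀ {X A} {h h′ : X C.⇒ S.F₀ A} → h C.≈ h′ → φ h A.≈ φ h′
    ψ-resp-≈ : ∀ {X A} {k k′ : A A.⇒ P.F₀ X} → k A.≈ k′ → ψ k C.≈ ψ k′
    ψ∘φ : ∀ {X A} (h : X C.⇒ S.F₀ A) → ψ (φ h) C.≈ h
    φ∘ψ : ∀ {X A} (k : A A.⇒ P.F₀ X) → φ (ψ k) A.≈ k
    φ-natural : ∀ {X X′ A A′} (f : X′ C.⇒ X) (g : A′ A.⇒ A) (h : X C.⇒ S.F₀ A) →
                φ (S.F₁ g C.∘ (h C.∘ f)) A.≈ P.F₁ f A.∘ (φ h A.∘ g)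

  η : ∀ X → X C.⇒ S.F₀ (P.F₀ X)
  η X = ψ (A.id {P.F₀ X})

module _ {o ℓ e o′ ℓ′ e′ : Level} {𝒞 : Category o ℓ e} {𝒜 : Category o′ ℓ′ e′} where
  private module C = Category 𝒞
  private module A = Category 𝒜

  record Logic (P : ContraFunctor 𝒞 𝒜) (T : Functor 𝒞 𝒞) (L : Functor 𝒜 𝒜)
         : Set (o ⊔ ℓ ⊔ e ⊔ o′ ⊔ ℓ′ ⊔ e′) where
    private module P = ContraFunctor P
    private module T = Functor T
    private module L = Functor L
    field
      ρ : ∀ X → L.F₀ (P.F₀ X) A.⇒ P.F₀ (T.F₀ X)
      ρ-natural : ∀ {X Y} (f : X C.⇒ Y) →
                  P.F₁ (T.F₁ f) A.∘ ρ Y A.≈ ρ X A.∘ L.F₁ (P.F₁ f)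

record IsInitialAlgebra {o ℓ e : Level} {𝒜 : Category o ℓ e} (L : Functor 𝒜 𝒜)
       (Φ : Category.Obj 𝒜) (α : Category._⇒_ 𝒜 (Functor.F₀ L Φ) Φ) : Set (o ⊔ ℓ ⊔ e) where
  open Category 𝒜
  open Functor L
  field
    fold : ∀ {D} (δ : F₀ D ⇒ D) → Φ ⇒ D
    fold-hom : ∀ {D} (δ : F₀ D ⇒ D) → fold δ ∘ α ≈ δ ∘ F₁ (fold δ)
    fold-unique : ∀ {D} (δ : F₀ D ⇒ D) (h : Φ ⇒ D) →
                  h ∘ α ≈ δ ∘ F₁ h → h ≈ fold δ

module Semantics {o ℓ e o′ ℓ′ e′ : Level} {𝒞 : Category o ℓ e} {𝒜 : Category o′ ℓ′ e′}
       {P : ContraFunctor 𝒞 𝒜} {S : ContraFunctor 𝒜 𝒞} (adj : DualAdjunction P S)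
       {T : Functor 𝒞 𝒞} {L : Functor 𝒜 𝒜} (log : Logic P T L)
       {Φ : Category.Obj 𝒜} {α : Category._⇒_ 𝒜 (Functor.F₀ L Φ) Φ}
       (init : IsInitialAlgebra L Φ α) where
  private module C = Category 𝒞
  private module A = Category 𝒜
  private module P = ContraFunctor P
  private module S = ContraFunctor S
  private module T = Functor T
  private module L = Functor L
  open Logic log
  open IsInitialAlgebra init
  open DualAdjunction adj

  complex : ∀ {X} (γ : X C.⇒ T.F₀ X) → L.F₀ (P.F₀ X) A.⇒ P.F₀ X
  complex {X} γ = P.F₁ γ A.∘ ρ X

  ⟦_⟧ : ∀ {X} (γ : X C.⇒ T.F₀ X) → Φ A.⇒ P.F₀ X
  ⟦ γ ⟧ = fold (complex γ)

  th : ∀ {X} (γ : X C.⇒ T.F₀ X) → X C.⇒ S.F₀ Φ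
  th {X} γ = S.F₁ ⟦ γ ⟧ C.∘ η X

  -- ρ-bisimulation, relative to a given dual span (B̄, π̄₁, π̄₂), i.e. a pullback
  -- in 𝒜 of  P X₁ --Pπ₁--> P B <--Pπ₂-- P X₂
  record IsRhoBisimulation {X₁ X₂ B : C.Obj}
         (γ₁ : X₁ C.⇒ T.F₀ X₁) (γ₂ : X₂ C.⇒ T.F₀ X₂)
         (π₁ : B C.⇒ X₁) (π₂ : B C.⇒ X₂)
         {B̄ : A.Obj} (π̄₁ : B̄ A.⇒ P.F₀ X₁) (π̄₂ : B̄ A.⇒ P.F₀ X₂)
         : Set (o ⊔ ℓ ⊔ e ⊔ o′ ⊔ ℓ′ ⊔ e′) where
    field
      jointly-mono : JointlyMono 𝒞 π₁ π₂
      dual-span-pullback : IsPullback 𝒜 (P.F₁ π₁) (P.F₁ π₂) π̄₁ π̄₂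
      condition : P.F₁ π₁ A.∘ (complex γ₁ A.∘ L.F₁ π̄₁)
                  A.≈ P.F₁ π₂ A.∘ (complex γ₂ A.∘ L.F₁ π̄₂)

{-# OPTIONS --safe #-}
-- The ρ-bisimulation condition says precisely that the two complex-algebra
-- structures, restricted along π̄₁ and π̄₂, agree after applying Pπ₁ and Pπ₂;
-- so the pullback B̄ carries an L-algebra structure β making π̄₁ and π̄₂
-- algebra morphisms. By initiality ⟦-⟧_γᵢ = π̄ᵢ ∘ fold β, hence
-- Pπ₁ ∘ ⟦-⟧_γ₁ = Pπ₂ ∘ ⟦-⟧_γ₂, and th_γᵢ ∘ πᵢ is the adjoint transpose of
-- exactly these maps.
module Submission where

open import Defs
open import Level using (Level)
open import Data.Product using (_×_)
open import Data.Sum using (_⊎_)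
open import Relation.Binary using (Setoid; IsEquivalence)
import Relation.Binary.Reasoning.Setoid as SetoidReasoning

hom-setoid : {o ℓ e : Level} (𝒞 : Category o ℓ e) →
             Category.Obj 𝒞 → Category.Obj 𝒞 → Setoid ℓ e
hom-setoid 𝒞 X Y = record
  { Carrier = X ⇒ Y ; _≈_ = _≈_ ; isEquivalence = equiv }
  where open Category 𝒞

module _ {o ℓ e : Level} {𝒜 : Category o ℓ e} {L : Functor 𝒜 𝒜}
         {Φ : Category.Obj 𝒜} {α : Category._⇒_ 𝒜 (Functor.F₀ L Φ) Φ}
         (init : IsInitialAlgebra L Φ α) where
  open Category 𝒜
  open Functor L
  open IsInitialAlgebra init
  private module ≈ {X Y} = IsEquivalence (equiv {X} {Y})

  fold-fusion : ∀ {D E} {δ : F₀ D ⇒ D} {ε : F₀ E ⇒ E} (h : D ⇒ E) →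
                h ∘ δ ≈ ε ∘ F₁ h → h ∘ fold δ ≈ fold ε
  fold-fusion {δ = δ} {ε} h h-hom = fold-unique ε (h ∘ fold δ) (begin
      (h ∘ fold δ) ∘ α          ≈⟨ assoc ⟩
      h ∘ (fold δ ∘ α)          ≈⟨ ∘-resp-≈ ≈.refl (fold-hom δ) ⟩
      h ∘ (δ ∘ F₁ (fold δ))     ≈⟨ ≈.sym assoc ⟩
      (h ∘ δ) ∘ F₁ (fold δ)     ≈⟨ ∘-resp-≈ h-hom ≈.refl ⟩
      (ε ∘ F₁ h) ∘ F₁ (fold δ)  ≈⟨ assoc ⟩
      ε ∘ (F₁ h ∘ F₁ (fold δ))  ≈⟨ ∘-resp-≈ ≈.refl (≈.sym homomorphism) ⟩
      ε ∘ F₁ (h ∘ fold δ)       ∎)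
    where open SetoidReasoning (hom-setoid 𝒜 _ _)

module _ {o ℓ e o′ ℓ′ e′ : Level} {𝒞 : Category o ℓ e} {𝒜 : Category o′ ℓ′ e′}
         {P : ContraFunctor 𝒞 𝒜} {S : ContraFunctor 𝒜 𝒞}
         (adj : DualAdjunction P S) where
  private
    module C = Category 𝒞
    module A = Category 𝒜
    module P = ContraFunctor P
    module S = ContraFunctor S
    module ≈A {X Y} = IsEquivalence (A.equiv {X} {Y})
    module ≈C {X Y} = IsEquivalence (C.equiv {X} {Y})
  open DualAdjunction adj

  S₁∘η∘-transpose : ∀ {X Y D} (f : Y C.⇒ X) (g : D A.⇒ P.F₀ X) →
                    S.F₁ g C.∘ (η X C.∘ f) C.≈ ψ (P.F₁ f A.∘ g)
  S₁∘η∘-transpose {X} f g =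
    ≈C.trans (≈C.sym (ψ∘φ _)) (ψ-resp-≈ (begin
      φ (S.F₁ g C.∘ (η X C.∘ f))   ≈⟨ φ-natural f g (η X) ⟩
      P.F₁ f A.∘ (φ (η X) A.∘ g)   ≈⟨ A.∘-resp-≈ ≈A.refl (A.∘-resp-≈ (φ∘ψ A.id) ≈A.refl) ⟩
      P.F₁ f A.∘ (A.id A.∘ g)      ≈⟨ A.∘-resp-≈ ≈A.refl A.identityˡ ⟩
      P.F₁ f A.∘ g                 ∎))
    where open SetoidReasoning (hom-setoid 𝒜 _ _)

module _ {o ℓ e o′ ℓ′ e′ : Level} {𝒞 : Category o ℓ e} {𝒜 : Category o′ ℓ′ e′}
         {P : ContraFunctor 𝒞 𝒜} {S : ContraFunctor 𝒜 𝒞} (adj : DualAdjunction P S)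
         {T : Functor 𝒞 𝒞} {L : Functor 𝒜 𝒜} (log : Logic P T L)
         {Φ : Category.Obj 𝒜} {α : Category._⇒_ 𝒜 (Functor.F₀ L Φ) Φ}
         (init : IsInitialAlgebra L Φ α) where
  private
    module C = Category 𝒞
    module A = Category 𝒜
    module P = ContraFunctor P
    module T = Functor T
    module L = Functor L
    module ≈A {X Y} = IsEquivalence (A.equiv {X} {Y})
    module ≈C {X Y} = IsEquivalence (C.equiv {X} {Y})
  open Semantics adj log init
  open DualAdjunction adj using (ψ)
  open IsInitialAlgebra init using (fold)

  th∘≈ψ[P₁∘⟦⟧] : ∀ {X Y} (γ : X C.⇒ T.F₀ X) (f : Y C.⇒ X) →
                 th γ C.∘ f C.≈ ψ (P.F₁ f A.∘ ⟦ γ ⟧)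
  th∘≈ψ[P₁∘⟦⟧] γ f = ≈C.trans C.assoc (S₁∘η∘-transpose adj f ⟦ γ ⟧)

  module _ {X₁ X₂ B : C.Obj} {γ₁ : X₁ C.⇒ T.F₀ X₁} {γ₂ : X₂ C.⇒ T.F₀ X₂}
           {π₁ : B C.⇒ X₁} {π₂ : B C.⇒ X₂}
           {B̄ : A.Obj} {π̄₁ : B̄ A.⇒ P.F₀ X₁} {π̄₂ : B̄ A.⇒ P.F₀ X₂}
           (pullback : IsPullback 𝒜 (P.F₁ π₁) (P.F₁ π₂) π̄₁ π̄₂)
           (condition : P.F₁ π₁ A.∘ (complex γ₁ A.∘ L.F₁ π̄₁)
                        A.≈ P.F₁ π₂ A.∘ (complex γ₂ A.∘ L.F₁ π̄₂)) where
    private module PB = IsPullback pullback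

    dual-span-algebra : L.F₀ B̄ A.⇒ B̄
    dual-span-algebra =
      PB.universal (complex γ₁ A.∘ L.F₁ π̄₁) (complex γ₂ A.∘ L.F₁ π̄₂) condition

    P₁π₁∘⟦γ₁⟧≈P₁π₂∘⟦γ₂⟧ : P.F₁ π₁ A.∘ ⟦ γ₁ ⟧ A.≈ P.F₁ π₂ A.∘ ⟦ γ₂ ⟧
    P₁π₁∘⟦γ₁⟧≈P₁π₂∘⟦γ₂⟧ = begin
        P.F₁ π₁ A.∘ ⟦ γ₁ ⟧             ≈⟨ A.∘-resp-≈ ≈A.refl (≈A.sym ⟦γ₁⟧-factors) ⟩
        P.F₁ π₁ A.∘ (π̄₁ A.∘ fold β)    ≈⟨ ≈A.sym A.assoc ⟩
        (P.F₁ π₁ A.∘ π̄₁) A.∘ fold β    ≈⟨ A.∘-resp-≈ PB.commute ≈A.refl ⟩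
        (P.F₁ π₂ A.∘ π̄₂) A.∘ fold β    ≈⟨ A.assoc ⟩
        P.F₁ π₂ A.∘ (π̄₂ A.∘ fold β)    ≈⟨ A.∘-resp-≈ ≈A.refl ⟦γ₂⟧-factors ⟩
        P.F₁ π₂ A.∘ ⟦ γ₂ ⟧             ∎
      where
      open SetoidReasoning (hom-setoid 𝒜 _ _)
      β : L.F₀ B̄ A.⇒ B̄
      β = dual-span-algebra
      ⟦γ₁⟧-factors : π̄₁ A.∘ fold β A.≈ ⟦ γ₁ ⟧
      ⟦γ₁⟧-factors = fold-fusion init π̄₁ (PB.p₁∘universal condition)
      ⟦γ₂⟧-factors : π̄₂ A.∘ fold β A.≈ ⟦ γ₂ ⟧
      ⟦γ₂⟧-factors = fold-fusion init π̄₂ (PB.p₂∘universal condition)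

proposition3p7 : {o ℓ e o′ ℓ′ e′ : Level}
    {𝒞 : Category o ℓ e} {𝒜 : Category o′ ℓ′ e′}
    → HasPullbacks 𝒞 × (HasPullbacks 𝒜 ⊎ HasPushouts 𝒞)
    → {P : ContraFunctor 𝒞 𝒜} {S : ContraFunctor 𝒜 𝒞} (adj : DualAdjunction P S)
    → {T : Functor 𝒞 𝒞} {L : Functor 𝒜 𝒜} (log : Logic P T L)
    → {Φ : Category.Obj 𝒜} {α : Category._⇒_ 𝒜 (Functor.F₀ L Φ) Φ}
    → (init : IsInitialAlgebra L Φ α)
    → {X₁ X₂ B : Category.Obj 𝒞}
    → (γ₁ : Category._⇒_ 𝒞 X₁ (Functor.F₀ T X₁))
    → (γ₂ : Category._⇒_ 𝒞 X₂ (Functor.F₀ T X₂))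
    → (π₁ : Category._⇒_ 𝒞 B X₁) (π₂ : Category._⇒_ 𝒞 B X₂)
    → {B̄ : Category.Obj 𝒜}
    → (π̄₁ : Category._⇒_ 𝒜 B̄ (ContraFunctor.F₀ P X₁))
    → (π̄₂ : Category._⇒_ 𝒜 B̄ (ContraFunctor.F₀ P X₂))
    → Semantics.IsRhoBisimulation adj log init γ₁ γ₂ π₁ π₂ π̄₁ π̄₂
    → Category._≈_ 𝒞
        (Category._∘_ 𝒞 (Semantics.th adj log init γ₁) π₁)
        (Category._∘_ 𝒞 (Semantics.th adj log init γ₂) π₂)
proposition3p7 {𝒞 = 𝒞} {𝒜} _ {P} adj log init γ₁ γ₂ π₁ π₂ _ _ bisimulation = begin
    th γ₁ ∘ π₁                   ≈⟨ th∘≈ψ[P₁∘⟦⟧] adj log init γ₁ π₁ ⟩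
    ψ (F₁ π₁ ∘ᴬ ⟦ γ₁ ⟧)          ≈⟨ ψ-resp-≈ (P₁π₁∘⟦γ₁⟧≈P₁π₂∘⟦γ₂⟧ adj log init
                                               dual-span-pullback condition) ⟩
    ψ (F₁ π₂ ∘ᴬ ⟦ γ₂ ⟧)          ≈˘⟨ th∘≈ψ[P₁∘⟦⟧] adj log init γ₂ π₂ ⟩
    th γ₂ ∘ π₂                   ∎
  where
  open Category 𝒞 using (_∘_)
  open Category 𝒜 using () renaming (_∘_ to _∘ᴬ_)
  open ContraFunctor P using (F₁)
  open Semantics adj log init
  open DualAdjunction adj using (ψ; ψ-resp-≈)
  open IsRhoBisimulation bisimulation using (dual-span-pullback; condition)
  open SetoidReasoning (hom-setoid 𝒞 _ _)
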